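{- Let the diamond graph be the graph on vertices $d_1,d_2,d_3,d_4$ with edges $d_1d_2$, $d_1d_3$, $d_2d_3$, $d_2d_4$, $d_3d_4$ (i.e. $K_4$ minus the edge $d_1d_4$). Let $H$ be the $(d_1,2)$-ordering of the diamond graph. Then $R_<(H)\le 16$.
   Context: A $k$-ordering of a graph $H$ assigns distinct order-labels from $\{1,\ldots,|H|\}$ to $k$ of the vertices of $H$. For a vertex $v$ of $H$ and $1\le l\le |H|$, the $(v,l)$-ordering of $H$ is the 1-ordering in which $v$ receives order-label $l$ and no other vertex is labeled. An ordered 2-coloring on $n$ vertices is a red/blue coloring of the edges of the complete graph on vertex set $\{1,\ldots,n\}$. It contains a $k$-ordering $H$ (in a given color) if it has a subgraph isomorphic to $H$, all of whose edges have that color, such that for every $i$ the $i$-th smallest vertex of the copy corresponds to a vertex of $H$ that has order-label $i$ or no order-label. $R_<(H)$ is the least $n$ such that every ordered 2-coloring on $n$ vertices contains a monochromatic (red or blue) copy of $H$. -}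

module Defs where

open import Data.Nat using (ℕ; _≤_)
open import Data.Fin using (Fin; zero; suc; toℕ; _<_; _<?_)
open import Data.Fin.Patterns
open import Data.Maybe using (Maybe; just; nothing)
open import Data.List using (length; filter; allFin)
open import Data.Product using (Σ; ∃; _×_; _,_)
open import Data.Sum using (_⊎_)
open import Data.Empty using (⊥)
open import Data.Unit using (⊤)
open import Relation.Binary.PropositionalEquality using (_≡_)
open import Relation.Nullary using (yes; no)
open import Function.Definitions using (Injective)

record Graph : Set₁ where
  field
    size  : ℕ
    Edge  : Fin size → Fin size → Set
    sym   : ∀ {u v} → Edge u v → Edge v u
    irrefl : ∀ {u} → Edge u u → ⊥

-- A partial ordering of a graph: some vertices receive distinct order-labels
-- from {1,…,|H|}; order-label ℓ ∈ Fin |H| stands for ℓ+1.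
record PartiallyOrderedGraph : Set₁ where
  field
    graph : Graph
  open Graph graph public
  field
    label : Fin size → Maybe (Fin size)
    label-distinct : ∀ {u v l} → label u ≡ just l → label v ≡ just l → u ≡ v

-- The diamond graph: d₁ = 0, d₂ = 1, d₃ = 2, d₄ = 3; edges
-- d₁d₂, d₁d₃, d₂d₃, d₂d₄, d₃d₄ (K₄ minus d₁d₄).
DiamondEdge : Fin 4 → Fin 4 → Set
DiamondEdge 0F 1F = ⊤
DiamondEdge 0F 2F = ⊤
DiamondEdge 1F 2F = ⊤
DiamondEdge 1F 3F = ⊤
DiamondEdge 2F 3F = ⊤
DiamondEdge 1F 0F = ⊤
DiamondEdge 2F 0F = ⊤
DiamondEdge 2F 1F = ⊤
DiamondEdge 3F 1F = ⊤
DiamondEdge 3F 2F = ⊤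
DiamondEdge _  _  = ⊥

diamond-sym : ∀ {u v} → DiamondEdge u v → DiamondEdge v u
diamond-sym {0F} {1F} _ = _
diamond-sym {0F} {2F} _ = _
diamond-sym {1F} {2F} _ = _
diamond-sym {1F} {3F} _ = _
diamond-sym {2F} {3F} _ = _
diamond-sym {1F} {0F} _ = _
diamond-sym {2F} {0F} _ = _
diamond-sym {2F} {1F} _ = _
diamond-sym {3F} {1F} _ = _
diamond-sym {3F} {2F} _ = _

diamond-irrefl : ∀ {u} → DiamondEdge u u → ⊥
diamond-irrefl {0F} ()
diamond-irrefl {1F} ()
diamond-irrefl {2F} ()
diamond-irrefl {3F} ()

Diamond : Graph
Diamond = record { size = 4 ; Edge = DiamondEdge ; sym = diamond-sym ; irrefl = diamond-irrefl }

-- The (v,l)-ordering of a graph G (l given 0-based: l : Fin |G| stands for l+1).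
vl-label : (G : Graph) → Fin (Graph.size G) → Fin (Graph.size G) →
           Fin (Graph.size G) → Maybe (Fin (Graph.size G))
vl-label G v l u with u Data.Fin.≟ v
... | yes _ = just l
... | no  _ = nothing

vl-distinct : (G : Graph) (v l : Fin (Graph.size G)) →
  ∀ {u w m} → vl-label G v l u ≡ just m → vl-label G v l w ≡ just m → u ≡ w
vl-distinct G v l {u} {w} p q with u Data.Fin.≟ v | w Data.Fin.≟ v
vl-distinct G v l {u} {w} p q | yes u≡v | yes w≡v =
  Relation.Binary.PropositionalEquality.trans u≡v (Relation.Binary.PropositionalEquality.sym w≡v)
vl-distinct G v l {u} {w} p () | yes _ | no _
vl-distinct G v l {u} {w} () q | no _ | _

vl-ordering : (G : Graph) → Fin (Graph.size G) → Fin (Graph.size G) → PartiallyOrderedGraph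
vl-ordering G v l = record { graph = G ; label = vl-label G v l ; label-distinct = vl-distinct G v l }

-- H = the (d₁, 2)-ordering of the diamond (order-label 2 is 1F, 0-based).
H : PartiallyOrderedGraph
H = vl-ordering Diamond 0F 1F

data Color : Set where
  red blue : Color

Coloring : ℕ → Set
Coloring n = (i j : Fin n) → i < j → Color

HasColor : ∀ {n} → Coloring n → Color → Fin n → Fin n → Set
HasColor χ c i j = (Σ (i < j) λ p → χ i j p ≡ c) ⊎ (Σ (j < i) λ p → χ j i p ≡ c)

-- rank of f v within the image of f: number of vertices w with f w < f v
-- (so f v is the (rank+1)-th smallest vertex of the copy)
rank : ∀ {h n} → (Fin h → Fin n) → Fin h → ℕ
rank {h} f v = length (filter (λ w → f w <? f v) (allFin h))

Contains : ∀ {n} → Coloring n → Color → PartiallyOrderedGraph → Set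
Contains {n} χ c H =
  Σ (Fin size → Fin n) λ f →
    Injective _≡_ _≡_ f
    × (∀ u v → Edge u v → HasColor χ c (f u) (f v))
    × (∀ v l → label v ≡ just l → rank f v ≡ toℕ l)
  where open PartiallyOrderedGraph H

RamseyProperty : PartiallyOrderedGraph → ℕ → Set
RamseyProperty H n = (χ : Coloring n) → Contains χ red H ⊎ Contains χ blue H

-- R_<(H) ≤ N : the least n with the Ramsey property is at most N,
-- i.e. some n ≤ N has the Ramsey property.
OrderedRamsey≤ : PartiallyOrderedGraph → ℕ → Set
OrderedRamsey≤ H N = ∃ λ n → n ≤ N × RamseyProperty H n

-- Already 14 vertices suffice. Fix vertex 0 and sort every other vertex v into one of four
-- classes by the colour c of the edge 0v and by whether v has a partner: a vertex u with
-- 0 < u < v whose edges 0u and uv also have colour c. Among 13 vertices one class has four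
-- members v₀ < v₁ < v₂ < v₃. If an edge xy with x < y between two of them has the class
-- colour c, then x is a partner of y, so x has a partner u as well, and 0 < u < x < y span a
-- diamond of colour c with d₁ = u. Otherwise the edges v₀v₁, v₀v₂, v₁v₂, v₀v₃, v₂v₃ all have
-- the other colour and form a diamond with d₁ = v₁.
module Submission where

open import Defs
open import Data.Bool using (Bool; true; false)
open import Data.Fin as Fin using (Fin; zero; suc; toℕ; fromℕ<; _<?_)
open import Data.Fin.Patterns
open import Data.Fin.Properties as Fin using (any?; toℕ-fromℕ<; <⇒≢; <-irrefl; <-asym; <-trans)
open import Data.List using ([]; _∷_; length; filter)
open import Data.List.Properties using (filter-accept; filter-reject)
open import Data.Maybe using (just)
open import Data.Nat as ℕ using (ℕ; zero; suc; _+_; z<s; s<s)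
open import Data.Nat.Properties as ℕ using (+-0-monoid; +-suc; ≤-refl; <⇒≤; n≤1+n; <-≤-trans)
open import Algebra.Properties.Monoid.Sum +-0-monoid using (sum)
open import Data.Product using (∃; _×_; _,_; proj₁)
open import Data.Product.Properties using (,-injectiveʳ)
open import Data.Sum using (_⊎_; inj₁; inj₂; swap)
open import Data.Vec.Functional using (Vector; updateAt; head; tail)
open import Data.Vec.Functional.Properties using (updateAt-updates; updateAt-minimal)
open import Function using (const; _∘′_)
open import Relation.Binary.PropositionalEquality
open import Relation.Nullary using (Dec; yes; no; does; proof; contradiction)
open import Relation.Nullary.Reflects using (Reflects; invert)
open import Relation.Nullary.Decidable using (dec-true; _×-dec_)

open ≡-Reasoning

colour : ∀ {n} → Coloring n → Fin n → Fin n → Color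
colour χ i j with i <? j | j <? i
... | yes i<j | _       = χ i j i<j
... | no _    | yes j<i = χ j i j<i
... | no _    | no _    = red

colour⇒HasColor : ∀ {n} (χ : Coloring n) {c i j} → i Fin.< j → colour χ i j ≡ c → HasColor χ c i j
colour⇒HasColor χ {i = i} {j} i<j e with i <? j
... | yes i<j′ = inj₁ (i<j′ , e)
... | no i≮j   = contradiction i<j i≮j

colour⇒HasColorʳ : ∀ {n} (χ : Coloring n) {c i j} → i Fin.< j → colour χ i j ≡ c → HasColor χ c j i
colour⇒HasColorʳ χ i<j e = swap (colour⇒HasColor χ i<j e)

module _ {n} (χ : Coloring n) (c : Color) {d₁ d₂ d₃ d₄ : Fin n}
         (d₂<d₁ : d₂ Fin.< d₁) (d₁<d₃ : d₁ Fin.< d₃) (d₃<d₄ : d₃ Fin.< d₄) where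

  private
    d₂<d₃ : d₂ Fin.< d₃
    d₂<d₃ = <-trans d₂<d₁ d₁<d₃

    d₂<d₄ : d₂ Fin.< d₄
    d₂<d₄ = <-trans d₂<d₃ d₃<d₄

    d₁<d₄ : d₁ Fin.< d₄
    d₁<d₄ = <-trans d₁<d₃ d₃<d₄

    copy : Fin 4 → Fin n
    copy 0F = d₁
    copy 1F = d₂
    copy 2F = d₃
    copy 3F = d₄

    copy-injective : ∀ {u v} → copy u ≡ copy v → u ≡ v
    copy-injective {0F} {0F} _ = refl
    copy-injective {1F} {1F} _ = refl
    copy-injective {2F} {2F} _ = refl
    copy-injective {3F} {3F} _ = refl
    copy-injective {0F} {1F} e = contradiction (sym e) (<⇒≢ d₂<d₁)
    copy-injective {0F} {2F} e = contradiction e (<⇒≢ d₁<d₃)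
    copy-injective {0F} {3F} e = contradiction e (<⇒≢ d₁<d₄)
    copy-injective {1F} {0F} e = contradiction e (<⇒≢ d₂<d₁)
    copy-injective {1F} {2F} e = contradiction e (<⇒≢ d₂<d₃)
    copy-injective {1F} {3F} e = contradiction e (<⇒≢ d₂<d₄)
    copy-injective {2F} {0F} e = contradiction (sym e) (<⇒≢ d₁<d₃)
    copy-injective {2F} {1F} e = contradiction (sym e) (<⇒≢ d₂<d₃)
    copy-injective {2F} {3F} e = contradiction e (<⇒≢ d₃<d₄)
    copy-injective {3F} {0F} e = contradiction (sym e) (<⇒≢ d₁<d₄)
    copy-injective {3F} {1F} e = contradiction (sym e) (<⇒≢ d₂<d₄)
    copy-injective {3F} {2F} e = contradiction (sym e) (<⇒≢ d₃<d₄)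

    rank-d₁ : rank copy 0F ≡ 1
    rank-d₁ = cong length (begin
      filter P? (0F ∷ 1F ∷ 2F ∷ 3F ∷ []) ≡⟨ filter-reject P? (<-irrefl refl) ⟩
      filter P? (1F ∷ 2F ∷ 3F ∷ [])      ≡⟨ filter-accept P? d₂<d₁ ⟩
      1F ∷ filter P? (2F ∷ 3F ∷ [])      ≡⟨ cong (1F ∷_) (filter-reject P? (<-asym d₁<d₃)) ⟩
      1F ∷ filter P? (3F ∷ [])           ≡⟨ cong (1F ∷_) (filter-reject P? (<-asym d₁<d₄)) ⟩
      1F ∷ []                            ∎)
      where P? = λ w → copy w <? d₁

    copy-labels : ∀ v l → vl-label Diamond 0F 1F v ≡ just l → rank copy v ≡ toℕ l
    copy-labels 0F _ refl = rank-d₁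

  diamond-copy : colour χ d₂ d₁ ≡ c → colour χ d₁ d₃ ≡ c → colour χ d₂ d₃ ≡ c →
                 colour χ d₂ d₄ ≡ c → colour χ d₃ d₄ ≡ c → Contains χ c H
  diamond-copy e₂₁ e₁₃ e₂₃ e₂₄ e₃₄ = copy , copy-injective , edges , copy-labels
    where
    edges : ∀ u v → DiamondEdge u v → HasColor χ c (copy u) (copy v)
    edges 0F 1F _ = colour⇒HasColorʳ χ d₂<d₁ e₂₁
    edges 0F 2F _ = colour⇒HasColor  χ d₁<d₃ e₁₃
    edges 1F 2F _ = colour⇒HasColor  χ d₂<d₃ e₂₃
    edges 1F 3F _ = colour⇒HasColor  χ d₂<d₄ e₂₄
    edges 2F 3F _ = colour⇒HasColor  χ d₃<d₄ e₃₄
    edges 1F 0F _ = colour⇒HasColor  χ d₂<d₁ e₂₁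
    edges 2F 0F _ = colour⇒HasColorʳ χ d₁<d₃ e₁₃
    edges 2F 1F _ = colour⇒HasColorʳ χ d₂<d₃ e₂₃
    edges 3F 1F _ = colour⇒HasColorʳ χ d₂<d₄ e₂₄
    edges 3F 2F _ = colour⇒HasColorʳ χ d₃<d₄ e₃₄

data Chain {m} (P : Fin m → Set) : ℕ → ℕ → Set where
  []   : ∀ {b} → Chain P 0 b
  cons : ∀ {r b} x → P x → toℕ x ℕ.< b → Chain P r (toℕ x) → Chain P (suc r) b

Chain-weaken : ∀ {m} {P : Fin m → Set} {r b b′} → b ℕ.≤ b′ → Chain P r b → Chain P r b′
Chain-weaken _    []                 = []
Chain-weaken b≤b′ (cons x px x<b xs) = cons x px (<-≤-trans x<b b≤b′) xs

sum-updateAt-pred : ∀ {k} (t : Vector ℕ k) i {c} → t i ≡ suc c →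
                    sum t ≡ suc (sum (updateAt t i (const c)))
sum-updateAt-pred t zero    eq = cong (_+ sum (tail t)) eq
sum-updateAt-pred t (suc i) eq = begin
  head t + sum (tail t)                               ≡⟨ cong (head t +_) (sum-updateAt-pred (tail t) i eq) ⟩
  head t + suc (sum (updateAt (tail t) i (const _)))  ≡⟨ +-suc (head t) _ ⟩
  suc (head t + sum (updateAt (tail t) i (const _)))  ∎

pigeonhole-chain : ∀ {m k} (class : Fin m → Fin k) (t : Vector ℕ k) → sum t ℕ.< m →
                   ∃ λ j → Chain (λ x → class x ≡ j) (suc (t j)) m
pigeonhole-chain {m} {k} class = prefix m ≤-refl
  where
  InClass : Fin k → Fin m → Set
  InClass j x = class x ≡ j

  Conclusion : ℕ → Set
  Conclusion b = ∀ t → sum t ℕ.< b → ∃ λ j → Chain (InClass j) (suc (t j)) b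

  step : ∀ x {b} → toℕ x ≡ b → Conclusion b → Conclusion (suc b)
  step x refl ih t Σt<1+x with t (class x) in tx
  ... | zero  = class x , subst (λ r → Chain (InClass (class x)) (suc r) (suc (toℕ x))) (sym tx)
                                (cons x refl ≤-refl [])
  ... | suc c with ih (updateAt t (class x) (const c))
                      (ℕ.≤-pred (subst (ℕ._< suc (toℕ x)) (sum-updateAt-pred t (class x) tx) Σt<1+x))
  ...   | j , xs with class x Fin.≟ j
  ...     | yes refl = j , subst (λ r → Chain (InClass j) (suc r) (suc (toℕ x))) (sym tx)
                               (cons x refl ≤-refl (subst (λ r → Chain (InClass j) (suc r) (toℕ x))
                                                          (updateAt-updates j t) xs))
  ...     | no j₀≢j = j , Chain-weaken (n≤1+n (toℕ x))
                            (subst (λ r → Chain (InClass j) (suc r) (toℕ x))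
                                   (updateAt-minimal j (class x) t (j₀≢j ∘′ sym)) xs)

  prefix : ∀ b → b ℕ.≤ m → Conclusion b
  prefix zero    _   _ ()
  prefix (suc b) b<m = step (fromℕ< b<m) (toℕ-fromℕ< b<m) (prefix b (<⇒≤ b<m))

flip : Color → Color
flip red  = blue
flip blue = red

same-or-flipped : ∀ c′ c → c′ ≡ c ⊎ c′ ≡ flip c
same-or-flipped red  red  = inj₁ refl
same-or-flipped red  blue = inj₂ refl
same-or-flipped blue red  = inj₂ refl
same-or-flipped blue blue = inj₁ refl

red-or-blue : ∀ {p} {P : Color → Set p} → ∃ P → P red ⊎ P blue
red-or-blue (red  , p) = inj₁ p
red-or-blue (blue , p) = inj₂ p

_≟ᶜ_ : (c c′ : Color) → Dec (c ≡ c′)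
red  ≟ᶜ red  = yes refl
red  ≟ᶜ blue = no λ ()
blue ≟ᶜ red  = no λ ()
blue ≟ᶜ blue = yes refl

encode : Color × Bool → Fin 4
encode (red  , false) = 0F
encode (red  , true)  = 1F
encode (blue , false) = 2F
encode (blue , true)  = 3F

decode : Fin 4 → Color × Bool
decode 0F = red  , false
decode 1F = red  , true
decode 2F = blue , false
decode 3F = blue , true

decode-encode : ∀ p → decode (encode p) ≡ p
decode-encode (red  , false) = refl
decode-encode (red  , true)  = refl
decode-encode (blue , false) = refl
decode-encode (blue , true)  = refl

colourOf : Fin 4 → Color
colourOf j = proj₁ (decode j)

encode-injective : ∀ {p q} → encode p ≡ encode q → p ≡ q
encode-injective {p} {q} e = begin
  p                 ≡⟨ sym (decode-encode p) ⟩
  decode (encode p) ≡⟨ cong decode e ⟩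
  decode (encode q) ≡⟨ decode-encode q ⟩
  q                 ∎

module Ramsey14 (χ : Coloring 14) where

  c₀ : Fin 13 → Color
  c₀ w = colour χ 0F (suc w)

  c : Fin 13 → Fin 13 → Color
  c u w = colour χ (suc u) (suc w)

  Partner : Fin 13 → Fin 13 → Set
  Partner w u = u Fin.< w × c₀ u ≡ c₀ w × c u w ≡ c₀ w

  partner? : ∀ w → Dec (∃ (Partner w))
  partner? w = any? λ u → (u <? w) ×-dec (c₀ u ≟ᶜ c₀ w) ×-dec (c u w ≟ᶜ c₀ w)

  class : Fin 13 → Fin 4
  class w = encode (c₀ w , does (partner? w))

  class-injective : ∀ {x y} → class x ≡ class y → (c₀ x , does (partner? x)) ≡ (c₀ y , does (partner? y))
  class-injective = encode-injective

  class⇒partner : ∀ {x y} → class x ≡ class y → ∃ (Partner y) → ∃ (Partner x)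
  class⇒partner {x} {y} eq p =
    invert (subst (Reflects _) (trans (,-injectiveʳ (class-injective eq)) (dec-true (partner? y) p)) (proof (partner? x)))

  class-colour : ∀ {j w} → class w ≡ j → c₀ w ≡ colourOf j
  class-colour {w = w} refl = cong proj₁ (sym (decode-encode (c₀ w , does (partner? w))))

  monochromatic-pair : ∀ {j x y} → class x ≡ j → class y ≡ j → x Fin.< y → c x y ≡ colourOf j →
                       Contains χ (colourOf j) H
  monochromatic-pair ex ey x<y cxy
    with u , u<x , c₀u≡c₀x , cux≡c₀x ← class⇒partner (trans ex (sym ey))
                                         (_ , x<y , trans (class-colour ex) (sym (class-colour ey)) ,
                                          trans cxy (sym (class-colour ey)))
    = diamond-copy χ _ z<s (s<s u<x) (s<s x<y) (trans c₀u≡c₀x (class-colour ex))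
                   (trans cux≡c₀x (class-colour ex)) (class-colour ex) (class-colour ey) cxy

  four-in-class : ∀ {j w₀ w₁ w₂ w₃} → class w₀ ≡ j → class w₁ ≡ j → class w₂ ≡ j → class w₃ ≡ j →
                  w₀ Fin.< w₁ → w₁ Fin.< w₂ → w₂ Fin.< w₃ → ∃ λ k → Contains χ k H
  four-in-class {j} {w₀} {w₁} {w₂} {w₃} e₀ e₁ e₂ e₃ w₀<w₁ w₁<w₂ w₂<w₃
    with same-or-flipped (c w₀ w₁) (colourOf j) | same-or-flipped (c w₁ w₂) (colourOf j)
       | same-or-flipped (c w₀ w₂) (colourOf j) | same-or-flipped (c w₀ w₃) (colourOf j)
       | same-or-flipped (c w₂ w₃) (colourOf j)
  ... | inj₁ e | _ | _ | _ | _ = _ , monochromatic-pair e₀ e₁ w₀<w₁ e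
  ... | inj₂ _ | inj₁ e | _ | _ | _ = _ , monochromatic-pair e₁ e₂ w₁<w₂ e
  ... | inj₂ _ | inj₂ _ | inj₁ e | _ | _ = _ , monochromatic-pair e₀ e₂ (<-trans w₀<w₁ w₁<w₂) e
  ... | inj₂ _ | inj₂ _ | inj₂ _ | inj₁ e | _ =
        _ , monochromatic-pair e₀ e₃ (<-trans w₀<w₁ (<-trans w₁<w₂ w₂<w₃)) e
  ... | inj₂ _ | inj₂ _ | inj₂ _ | inj₂ _ | inj₁ e = _ , monochromatic-pair e₂ e₃ w₂<w₃ e
  ... | inj₂ f₀₁ | inj₂ f₁₂ | inj₂ f₀₂ | inj₂ f₀₃ | inj₂ f₂₃ =
        _ , diamond-copy χ _ (s<s w₀<w₁) (s<s w₁<w₂) (s<s w₂<w₃) f₀₁ f₁₂ f₀₂ f₀₃ f₂₃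

  monochromatic-H : Contains χ red H ⊎ Contains χ blue H
  monochromatic-H with pigeonhole-chain class (const 3) ≤-refl
  ... | _ , cons _ e₃ _ (cons _ e₂ w₂<w₃ (cons _ e₁ w₁<w₂ (cons _ e₀ w₀<w₁ []))) =
    red-or-blue (four-in-class e₀ e₁ e₂ e₃ w₀<w₁ w₁<w₂ w₂<w₃)

theorem3p8 : OrderedRamsey≤ H 16
theorem3p8 = 14 , ℕ.m≤m+n 14 2 , Ramsey14.monochromatic-H
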